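{- Let $G=(V,E)$ be a cocomparability graph with $|V|=n$ and let $\sigma=(u_1,u_2,\dots,u_n,u_{n+1})$ be an LDFS umbrella-free ordering of $V\cup\{u_{n+1}\}$, where $u_{n+1}$ is a dummy isolated vertex. Then for all indices $i,j\in\{1,\dots,n\}$ and every $u_x\in V(G(i+1,j))$, we have $V(G(i+1,x-1))\subseteq V(G(i,j))$.
   Context: Graphs are finite, simple, undirected; $N(v)$ is the neighborhood of $v$. An ordering $\sigma$ is umbrella-free if for all $x<_\sigma y<_\sigma z$, $xz\in E$ implies $xy\in E$ or $yz\in E$. For an ordering $\sigma$, a triple $(a,b,c)$ with $a<_\sigma b<_\sigma c$, $ac\in E$, $ab\notin E$ is good if there is a vertex $d$ with $a<_\sigma d<_\sigma b$, $db\in E$, $dc\notin E$, and bad otherwise; $\sigma$ is an LDFS ordering if it has no bad triple. Vertices are indexed by position in $\sigma$, and $u_{n+1}$ is adjacent to no vertex. For indices $i,j$: if $i>j$ then $G(i,j)$ is the empty graph; if $i\le j$ then $G(i,j)$ is the subgraph of $G$ induced by $\{u_i,\dots,u_j\}\setminus N(u_{j+1})$. -}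

module Defs where

open import Data.Nat using (ℕ; suc; _≤_; _<_)
open import Data.Product using (_×_; ∃-syntax)
open import Data.Sum using (_⊎_)
open import Relation.Nullary using (¬_)
open import Relation.Binary.PropositionalEquality using (_≡_)

-- Vertices are identified with their positions in σ: u_k is the natural number k.
-- The real vertices are 1..n; u_{n+1} = suc n is the dummy isolated vertex.

InV : ℕ → ℕ → Set
InV n x = 1 ≤ x × x ≤ n

-- finite simple undirected graph on vertex set {1,…,n}
-- (no edges leave {1..n}; in particular u_{n+1} is isolated)
SimpleGraph : (n : ℕ) → (ℕ → ℕ → Set) → Set
SimpleGraph n E =
  (∀ x → ¬ E x x) ×
  (∀ x y → E x y → E y x) ×
  (∀ x y → E x y → InV n x)

CoEdge : ℕ → (ℕ → ℕ → Set) → ℕ → ℕ → Set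
CoEdge n E x y = InV n x × InV n y × ¬ (x ≡ y) × ¬ E x y

TransitiveOrientation : (ℕ → ℕ → Set) → (ℕ → ℕ → Set) → Set
TransitiveOrientation F O =
  (∀ x y → O x y → F x y) ×
  (∀ x y → F x y → O x y ⊎ O y x) ×
  (∀ x y → O x y → ¬ O y x) ×
  (∀ x y z → O x y → O y z → O x z)

Cocomparability : (n : ℕ) → (ℕ → ℕ → Set) → Set₁
Cocomparability n E = ∃[ O ] TransitiveOrientation (CoEdge n E) O

UmbrellaFree : (n : ℕ) → (ℕ → ℕ → Set) → Set
UmbrellaFree n E = ∀ x y z → 1 ≤ x → x < y → y < z → z ≤ suc n →
  E x z → E x y ⊎ E y z

LDFS : (n : ℕ) → (ℕ → ℕ → Set) → Set
LDFS n E = ∀ a b c → 1 ≤ a → a < b → b < c → c ≤ suc n →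
  E a c → ¬ E a b →
  ∃[ d ] (a < d × d < b × E d b × ¬ E d c)

InGij : (ℕ → ℕ → Set) → ℕ → ℕ → ℕ → Set
InGij E i j x = i ≤ x × x ≤ j × ¬ E x (suc j)

-- If y < x ≤ j, y ≁ x and x ≁ u_{j+1}, then an edge y u_{j+1} would be an
-- umbrella over x.
module Submission where

open import Defs
open import Data.Nat using (ℕ; zero; suc; _≤_; _<_; _∸_; s≤s; z≤n)
open import Data.Nat.Properties using (≤-trans; n≤1+n)
open import Data.Product using (_,_)
open import Data.Sum using ([_,_])
open import Relation.Nullary using (¬_)

umbrella-nonadjacent : ∀ {n E} → UmbrellaFree n E →
  ∀ {x y z} → 1 ≤ x → x < y → y < z → z ≤ suc n →
  ¬ E x y → ¬ E y z → ¬ E x z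
umbrella-nonadjacent uf 1≤x x<y y<z z≤n+1 ¬xy ¬yz xz =
  [ ¬xy , ¬yz ] (uf _ _ _ 1≤x x<y y<z z≤n+1 xz)

lemma10 : (n : ℕ) (E : ℕ → ℕ → Set) →
    SimpleGraph n E → Cocomparability n E →
    UmbrellaFree n E → LDFS n E →
    ∀ i j → InV n i → InV n j →
    ∀ x → InGij E (suc i) j x →
    ∀ y → InGij E (suc i) (x ∸ 1) y → InGij E i j y
lemma10 _ _ _ _ _ _ _ _ _ _ zero (() , _ , _) _ _
lemma10 n E _ _ uf _ i j _ (_ , j≤n) (suc x) (_ , x+1≤j , ¬x+1~j+1) y (i<y , y≤x , ¬y~x+1) =
  i≤y , y≤j , umbrella-nonadjacent uf 1≤y (s≤s y≤x) (s≤s x+1≤j) (s≤s j≤n) ¬y~x+1 ¬x+1~j+1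
  where
  i≤y : i ≤ y
  i≤y = ≤-trans (n≤1+n i) i<y

  y≤j : y ≤ j
  y≤j = ≤-trans y≤x (≤-trans (n≤1+n x) x+1≤j)

  1≤y : 1 ≤ y
  1≤y = ≤-trans (s≤s z≤n) i<y
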